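{- Let $H=(V,E)$ be a nontrivial hypergraph with minimum degree $\delta(H)$. Then $\kappa_S(H) \leq \kappa'_W(H) \leq \delta(H)$.
   Context: A hypergraph $H=(V,E)$ consists of a finite set $V$ of vertices and a finite multiset $E=(e_i)_{i\in I}$ of edges, each edge being a submultiset of $V$ (edges may repeat, vertices may appear in an edge with multiplicity greater than one, and edges may have fewer than two distinct vertices). Let $m_{e}(v)$ denote the multiplicity of $v$ in edge $e$; the degree of $v$ is $\deg(v)=\sum_{i\in I} m_{e_i}(v)$ and $\delta(H)=\min_{v\in V}\deg(v)$. $H$ is null if $V=\emptyset$, trivial if $|V|=1$, and nontrivial otherwise. A walk is a sequence $v_1,e_1,v_2,\dots,e_s,v_{s+1}$ of vertices and edges with the multiset $[v_j,v_{j+1}]\subseteq e_j$ for all $j$; a path is a walk whose vertices are distinct and whose edges are distinct. $H$ is connected if every two vertices are joined by a path, and disconnected otherwise. For $X\subseteq V$, the strong deletion $H\setminus_S X$ is obtained by removing the vertices of $X$ from $V$ and removing from $E$ every edge containing a vertex of $X$. For a submultiset $F\subseteq E$, the weak deletion $H\setminus_W F$ is obtained by removing the edges of $F$ from $E$ (keeping all vertices). Strong vertex connectivity $\kappa_S(H)$: if $H$ is null or trivial, $\kappa_S(H)=1$; if $H$ is nontrivial and some $X\subseteq V$ makes $H\setminus_S X$ disconnected, $\kappa_S(H)$ is the minimum $|X|$ over such $X$; otherwise $\kappa_S(H)=|V|-1$. Weak edge connectivity $\kappa'_W(H)$: for nontrivial $H$, the minimum cardinality of a submultiset $F\subseteq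 E$ such that $H\setminus_W F$ is disconnected; for null or trivial $H$ it is $1$. -}

module Defs where

open import Data.Nat using (ℕ; zero; suc; _+_; _≤_; _⊓_)
open import Data.Fin using (Fin; zero; suc; _≟_)
open import Data.Fin.Subset using (Subset; _∈_; _∉_; ∣_∣)
open import Data.List using (List; []; _∷_; map; allFin)
open import Data.Nat.ListAction using (sum)
open import Data.List.Relation.Unary.All using (All)
open import Data.List.Relation.Unary.Unique.Propositional using (Unique)
open import Data.Product using (Σ; _×_; _,_)
open import Relation.Nullary using (¬_)
open import Relation.Nullary.Decidable using (⌊_⌋)
open import Relation.Binary.PropositionalEquality using (_≡_)
open import Data.Bool using (if_then_else_)

-- A hypergraph with vertex set Fin n and edge multiset indexed by Fin m.
-- Each edge is a submultiset of V, given by its multiplicity function.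
record Hypergraph (n m : ℕ) : Set where
  field
    edge : Fin m → Fin n → ℕ
open Hypergraph public

module _ {n m : ℕ} (H : Hypergraph n m) where

  deg : Fin n → ℕ
  deg v = sum (map (λ i → edge H i v) (allFin m))

  -- multiplicity of x in the two-element multiset [u , w]
  pairMult : Fin n → Fin n → Fin n → ℕ
  pairMult u w x = (if ⌊ x ≟ u ⌋ then 1 else 0) + (if ⌊ x ≟ w ⌋ then 1 else 0)

  PairIn : Fin n → Fin n → Fin m → Set
  PairIn u w i = ∀ x → pairMult u w x ≤ edge H i x

  data Walk : Fin n → Fin n → Set where
    here : (u : Fin n) → Walk u u
    step : ∀ {u w v} (i : Fin m) → PairIn u w i → Walk w v → Walk u v

  walkVertices : ∀ {u v} → Walk u v → List (Fin n)
  walkVertices (here u) = u ∷ []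
  walkVertices (step {u} i _ p) = u ∷ walkVertices p

  walkEdges : ∀ {u v} → Walk u v → List (Fin m)
  walkEdges (here u) = []
  walkEdges (step i _ p) = i ∷ walkEdges p

  -- A sub-hypergraph of H is given by a set of surviving vertices and a
  -- set of surviving edge indices (a submultiset of E).  In both deletion
  -- operations below every surviving edge only contains surviving vertices.
  record PathIn (Vs : Fin n → Set) (Es : Fin m → Set) (u v : Fin n) : Set where
    field
      walk     : Walk u v
      vsAlive  : All Vs (walkVertices walk)
      esAlive  : All Es (walkEdges walk)
      vsDist   : Unique (walkVertices walk)
      esDist   : Unique (walkEdges walk)

  ConnectedIn : (Fin n → Set) → (Fin m → Set) → Set
  ConnectedIn Vs Es = ∀ u v → Vs u → Vs v → PathIn Vs Es u v

  StrongDel-V : Subset n → Fin n → Set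
  StrongDel-V X v = v ∉ X

  StrongDel-E : Subset n → Fin m → Set
  StrongDel-E X i = ∀ v → v ∈ X → edge H i v ≡ 0

  StrongDisconnects : Subset n → Set
  StrongDisconnects X = ¬ ConnectedIn (StrongDel-V X) (StrongDel-E X)

  WeakDisconnects : Subset m → Set
  WeakDisconnects F = ¬ ConnectedIn (λ _ → Data.Unit.⊤) (λ i → i ∉ F)
    where import Data.Unit

  IsStrongVertexConnectivity : ℕ → Set
  IsStrongVertexConnectivity k =
      ((Σ (Subset n) λ X → StrongDisconnects X)
        → (Σ (Subset n) λ X → StrongDisconnects X × ∣ X ∣ ≡ k)
          × (∀ X → StrongDisconnects X → k ≤ ∣ X ∣))
    × ((¬ Σ (Subset n) λ X → StrongDisconnects X) → k ≡ Data.Nat._∸_ n 1)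

  IsWeakEdgeConnectivity : ℕ → Set
  IsWeakEdgeConnectivity k =
      (Σ (Subset m) λ F → WeakDisconnects F × ∣ F ∣ ≡ k)
    × (∀ F → WeakDisconnects F → k ≤ ∣ F ∣)

minFin : {k : ℕ} → (Fin (suc k) → ℕ) → ℕ
minFin {zero} f = f zero
minFin {suc k} f = f zero ⊓ minFin (λ j → f (suc j))

δ : {n m : ℕ} → Hypergraph (suc n) m → ℕ
δ H = minFin (deg H)

{-# OPTIONS --safe #-}
-- The edges at a vertex v of minimum degree weakly separate v from every
-- other vertex, which gives κ'_W ≤ δ.  For κ_S ≤ κ'_W take any weakly
-- disconnecting F, vertices a, b it separates, and the component C of b in
-- H \W F.  If some c ∈ C, d ∉ C are such that every edge of F leaving C has a
-- vertex besides c and d, deleting one such vertex from each edge of F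
-- strongly separates c from d with at most |F| vertices.  Otherwise every
-- such pair c, d is spanned by an edge of F with no other vertex, and the
-- vertices x ≠ a receive distinct such edges (to a when x ∈ C, from b when
-- x ∉ C), so |F| ≥ |V| - 1, which bounds κ_S in any case.  All minima exist
-- because connectivity is decidable: a path is a walk of bounded length, and
-- every walk shortcuts to a path.
module Submission where

open import Defs
open import Data.Empty using (⊥-elim)
open import Data.Fin using (Fin; zero; suc; punchIn) renaming (_≟_ to _≟ᶠ_)
open import Data.Fin.Properties using (any?; all?; ¬∀⟶∃¬; punchIn-injective; punchInᵢ≢i)
open import Data.Fin.Subset using (Subset; _∈_; _∉_; ∣_∣; _∪_; ⁅_⁆; _-_; inside; outside) renaming (⊥ to ∅)
open import Data.Fin.Subset.Properties
  using (_∈?_; anySubset?; ∉⊥; ∣⊥∣≡0; ∈⊤; ⊆⊤; ∣⊤∣≡n; x∈⁅x⁆; x∈⁅y⁆⇒x≡y; ∣⁅x⁆∣≡1; x∈p∪q⁻; x∈p∪q⁺;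
         p⊂q⇒∣p∣<∣q∣; x∈p⇒∣p-x∣<∣p∣; x∈p∧x≢y⇒x∈p-y)
open import Data.List using (List; []; _∷_; length; tabulate)
open import Data.List.Properties using (length-tabulate; map-tabulate)
open import Data.List.Relation.Unary.All as All using (All; []; _∷_)
import Data.List.Relation.Unary.All.Properties as All
open import Data.List.Relation.Unary.Unique.Propositional using (Unique)
import Data.List.Relation.Unary.Unique.Propositional.Properties as Unique
open import Data.Nat using (ℕ; zero; suc; _+_; _≤_; _<_; z≤n; s≤s; _≤?_; _≟_)
open import Data.Nat.ListAction using (sum)
open import Data.Nat.Properties
open import Data.Product using (Σ; ∃; ∃₂; _×_; _,_; proj₁; proj₂)
open import Data.Unit using (⊤; tt)
open import Data.Sum using (_⊎_; inj₁; inj₂; [_,_])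
open import Data.Vec using ([]; _∷_)
import Data.Vec as Vec
open import Data.Vec.Properties using (lookup∘tabulate; []=⇒lookup; lookup⇒[]=)
open import Data.List.Relation.Unary.AllPairs using ([]; _∷_)
open import Data.List.Relation.Unary.Any using (here; there)
import Data.List.Membership.DecPropositional as DecMem
open import Data.List.Membership.Propositional using () renaming (_∈_ to _∈ₗ_; _∉_ to _∉ₗ_)
open import Function using (_∘_; Injective)
open import Relation.Nullary using (¬_; Dec; yes; no; does)
open import Relation.Nullary.Decidable using (dec-true; map′; _×-dec_; _⊎-dec_; _→-dec_; ¬?; decidable-stable)
open import Relation.Unary using (Pred; Decidable)
open import Relation.Binary.PropositionalEquality using (_≡_; _≢_; refl; sym; trans; subst; cong)

∣p∪q∣≤∣p∣+∣q∣ : ∀ {k} (p q : Subset k) → ∣ p ∪ q ∣ ≤ ∣ p ∣ + ∣ q ∣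
∣p∪q∣≤∣p∣+∣q∣ []            []            = z≤n
∣p∪q∣≤∣p∣+∣q∣ (inside ∷ p)  (inside ∷ q)  =
  s≤s (≤-trans (∣p∪q∣≤∣p∣+∣q∣ p q) (+-monoʳ-≤ ∣ p ∣ (n≤1+n ∣ q ∣)))
∣p∪q∣≤∣p∣+∣q∣ (inside ∷ p)  (outside ∷ q) = s≤s (∣p∪q∣≤∣p∣+∣q∣ p q)
∣p∪q∣≤∣p∣+∣q∣ (outside ∷ p) (inside ∷ q)  =
  ≤-trans (s≤s (∣p∪q∣≤∣p∣+∣q∣ p q)) (≤-reflexive (sym (+-suc ∣ p ∣ ∣ q ∣)))
∣p∪q∣≤∣p∣+∣q∣ (outside ∷ p) (outside ∷ q) = ∣p∪q∣≤∣p∣+∣q∣ p q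

x∉p⇒∣p∣<n : ∀ {k x} (p : Subset k) → x ∉ p → ∣ p ∣ < k
x∉p⇒∣p∣<n {k} {x} p x∉p = subst (∣ p ∣ <_) (∣⊤∣≡n k) (p⊂q⇒∣p∣<∣q∣ (⊆⊤ , x , ∈⊤ , x∉p))

unique⇒length≤∣p∣ : ∀ {k} (p : Subset k) {xs : List (Fin k)} →
  Unique xs → All (_∈ p) xs → length xs ≤ ∣ p ∣
unique⇒length≤∣p∣ p {[]}     _            _            = z≤n
unique⇒length≤∣p∣ p {x ∷ xs} (x∉xs ∷ xs!) (x∈p ∷ xs⊆p) =
  ≤-trans (s≤s (unique⇒length≤∣p∣ (p - x) xs! xs⊆p-x)) (x∈p⇒∣p-x∣<∣p∣ x∈p)
  where
  xs⊆p-x : All (_∈ p - x) xs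
  xs⊆p-x = All.zipWith (λ (x≢y , y∈p) → x∈p∧x≢y⇒x∈p-y y∈p (x≢y ∘ sym)) (x∉xs , xs⊆p)

unique⇒length≤n : ∀ {k} {xs : List (Fin k)} → Unique xs → length xs ≤ k
unique⇒length≤n {k} {xs} xs! =
  subst (length xs ≤_) (∣⊤∣≡n k) (unique⇒length≤∣p∣ _ xs! (All.universal (λ _ → ∈⊤) xs))

injection⇒n≤∣p∣ : ∀ {n k} (p : Subset k) (f : Fin n → Fin k) →
  Injective _≡_ _≡_ f → (∀ i → f i ∈ p) → n ≤ ∣ p ∣
injection⇒n≤∣p∣ p f f-inj f∈p = subst (_≤ ∣ p ∣) (length-tabulate f)
  (unique⇒length≤∣p∣ p (Unique.tabulate⁺ f-inj) (All.tabulate⁺ f∈p))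

∣p∣≤sum : ∀ {k} (p : Subset k) (g : Fin k → ℕ) →
  (∀ {j} → j ∈ p → 1 ≤ g j) → ∣ p ∣ ≤ sum (tabulate g)
∣p∣≤sum []            g _    = z≤n
∣p∣≤sum (inside ∷ p)  g g>0 = +-mono-≤ (g>0 Vec.here) (∣p∣≤sum p (g ∘ suc) (g>0 ∘ Vec.there))
∣p∣≤sum (outside ∷ p) g g>0 = ≤-trans (∣p∣≤sum p (g ∘ suc) (g>0 ∘ Vec.there)) (m≤n+m _ (g zero))

toSubset : ∀ {k p} {P : Pred (Fin k) p} → Decidable P → Subset k
toSubset P? = Vec.tabulate (does ∘ P?)

∈toSubset⁺ : ∀ {k p} {P : Pred (Fin k) p} (P? : Decidable P) {x} → P x → x ∈ toSubset P?
∈toSubset⁺ P? {x} px = lookup⇒[]= x _ (trans (lookup∘tabulate _ x) (dec-true (P? x) px))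

∈toSubset⁻ : ∀ {k p} {P : Pred (Fin k) p} (P? : Decidable P) {x} → x ∈ toSubset P? → P x
∈toSubset⁻ P? {x} x∈ with P? x | trans (sym (lookup∘tabulate (does ∘ P?) x)) ([]=⇒lookup x∈)
... | yes px | _ = px
... | no _   | ()

smallestSubset : ∀ {k p} {P : Pred (Subset k) p} → Decidable P → ∃ P →
  Σ (Subset k) λ Y → P Y × (∀ Z → P Z → ∣ Y ∣ ≤ ∣ Z ∣)
smallestSubset {k} {P = P} P? (X , pX) = descend ∣ X ∣ X ≤-refl pX
  where
  descend : ∀ b X → ∣ X ∣ ≤ b → P X → Σ (Subset k) λ Y → P Y × (∀ Z → P Z → ∣ Y ∣ ≤ ∣ Z ∣)
  descend zero    X ∣X∣≤0 pX = X , pX , λ _ _ → ≤-trans ∣X∣≤0 z≤n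
  descend (suc b) X ∣X∣≤b pX with anySubset? (λ Z → P? Z ×-dec (suc ∣ Z ∣ ≤? ∣ X ∣))
  ... | yes (Z , pZ , ∣Z∣<∣X∣) = descend b Z (≤-pred (≤-trans ∣Z∣<∣X∣ ∣X∣≤b)) pZ
  ... | no  ¬smaller            = X , pX , λ Z pZ → ≮⇒≥ (λ ∣Z∣<∣X∣ → ¬smaller (Z , pZ , ∣Z∣<∣X∣))

minFin-attained : ∀ {k} (f : Fin (suc k) → ℕ) → ∃ λ j → f j ≤ minFin f
minFin-attained {zero}  f = zero , ≤-refl
minFin-attained {suc k} f with minFin-attained (f ∘ suc)
... | j , fj≤min with f zero ≤? f (suc j)
...   | yes f0≤fj = zero , ⊓-glb ≤-refl (≤-trans f0≤fj fj≤min)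
...   | no  f0≰fj = suc j , ⊓-glb (<⇒≤ (≰⇒> f0≰fj)) fj≤min

record Transversal {k N} (F : Subset k) (T : Fin k → Fin N → Set) : Set where
  field
    members : Subset N
    size    : ∣ members ∣ ≤ ∣ F ∣
    sound   : ∀ {x} → x ∈ members → ∃ λ j → T j x
    hits    : ∀ {j z} → j ∈ F → T j z → ∃ λ x → x ∈ members × T j x

transversal : ∀ {k N} (F : Subset k) (T : Fin k → Fin N → Set) →
  (∀ j → Decidable (T j)) → Transversal F T
transversal {N = N} [] T T? = record
  { members = ∅ ; size = ≤-reflexive (∣⊥∣≡0 N) ; sound = ⊥-elim ∘ ∉⊥ ; hits = λ () }
transversal (s ∷ F) T T? = extend s (any? (T? zero))
  where
  rest : Transversal F (T ∘ suc)
  rest = transversal F (T ∘ suc) (T? ∘ suc)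
  open Transversal rest

  soundRest : ∀ {x} → x ∈ members → ∃ λ j → T j x
  soundRest x∈ = let j , t = sound x∈ in suc j , t

  extend : ∀ s → Dec (∃ (T zero)) → Transversal (s ∷ F) T
  extend inside (yes (z , t)) = record
    { members = ⁅ z ⁆ ∪ members
    ; size    = ≤-trans (∣p∪q∣≤∣p∣+∣q∣ ⁅ z ⁆ members)
                        (subst (λ c → c + ∣ members ∣ ≤ suc ∣ F ∣) (sym (∣⁅x⁆∣≡1 z)) (s≤s size))
    ; sound   = λ x∈ → fromEither (x∈p∪q⁻ ⁅ z ⁆ members x∈)
    ; hits    = λ { Vec.here _ → z , x∈p∪q⁺ (inj₁ (x∈⁅x⁆ z)) , t
                  ; (Vec.there j∈F) t' → let x , x∈ , t'' = hits j∈F t' in x , x∈p∪q⁺ (inj₂ x∈) , t'' }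
    }
    where
    fromEither : ∀ {x} → x ∈ ⁅ z ⁆ ⊎ x ∈ members → ∃ λ j → T j x
    fromEither (inj₁ x∈⁅z⁆) rewrite x∈⁅y⁆⇒x≡y z x∈⁅z⁆ = zero , t
    fromEither (inj₂ x∈)    = soundRest x∈
  extend inside (no ¬t) = record
    { members = members ; size = m≤n⇒m≤1+n size ; sound = soundRest
    ; hits = λ { Vec.here t → ⊥-elim (¬t (_ , t)) ; (Vec.there j∈F) t → hits j∈F t } }
  extend outside _ = record
    { members = members ; size = size ; sound = soundRest
    ; hits = λ { (Vec.there j∈F) t → hits j∈F t } }

module Walks {N m : ℕ} (H : Hypergraph N m) where

  Incident : Fin m → Fin N → Set
  Incident i x = 1 ≤ edge H i x

  ≡0⇒¬incident : ∀ {i x} → edge H i x ≡ 0 → ¬ Incident i x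
  ≡0⇒¬incident i∌x x∈i = 1+n≰n (subst (1 ≤_) i∌x x∈i)

  pairIn⇒incidentˡ : ∀ {u w i} → PairIn H u w i → Incident i u
  pairIn⇒incidentˡ {u} {w} u,w∈i = ≤-trans 1≤pairMult (u,w∈i u)
    where
    1≤pairMult : 1 ≤ pairMult H u w u
    1≤pairMult with u ≟ᶠ u
    ... | yes _   = s≤s z≤n
    ... | no  u≢u = ⊥-elim (u≢u refl)

  pairIn⇒incidentʳ : ∀ {u w i} → PairIn H u w i → Incident i w
  pairIn⇒incidentʳ {u} {w} u,w∈i = ≤-trans 1≤pairMult (u,w∈i w)
    where
    1≤pairMult : 1 ≤ pairMult H u w w
    1≤pairMult with w ≟ᶠ w
    ... | yes _   = m≤n+m 1 _
    ... | no  w≢w = ⊥-elim (w≢w refl)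

  incident⇒pairIn : ∀ {u w i} → u ≢ w → Incident i u → Incident i w → PairIn H u w i
  incident⇒pairIn {u} {w} u≢w u∈i w∈i x with x ≟ᶠ u | x ≟ᶠ w
  ... | yes refl | yes u≡w = ⊥-elim (u≢w u≡w)
  ... | yes refl | no  _   = u∈i
  ... | no  _    | yes refl = w∈i
  ... | no  _    | no  _    = z≤n

  pairIn? : ∀ u w i → Dec (PairIn H u w i)
  pairIn? u w i = all? (λ x → pairMult H u w x ≤? edge H i x)

  head∈walkVertices : ∀ {u v} (w : Walk H u v) → u ∈ₗ walkVertices H w
  head∈walkVertices (here _)     = here refl
  head∈walkVertices (step _ _ _) = here refl

  length-walkVertices : ∀ {u v} (w : Walk H u v) →
    length (walkVertices H w) ≡ suc (length (walkEdges H w))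
  length-walkVertices (here _)     = refl
  length-walkVertices (step _ _ w) = cong suc (length-walkVertices w)

  module Paths (Vs : Fin N → Set) (Es : Fin m → Set) where

    Path : Fin N → Fin N → Set
    Path = PathIn H Vs Es

    vertices : ∀ {u v} → Path u v → List (Fin N)
    vertices P = walkVertices H (PathIn.walk P)

    edges : ∀ {u v} → Path u v → List (Fin m)
    edges P = walkEdges H (PathIn.walk P)

    pathFrom : ∀ {u y v} (P : Path y v) → u ∈ₗ vertices P → Path u v
    pathFrom P@(record { walk = here _ })     (here refl) = P
    pathFrom P@(record { walk = step _ _ _ }) (here refl) = P
    pathFrom record { walk = step i _ w ; vsAlive = _ ∷ vs ; esAlive = _ ∷ es
                    ; vsDist = _ ∷ vs! ; esDist = _ ∷ es! } (there u∈) =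
      pathFrom record { walk = w ; vsAlive = vs ; esAlive = es ; vsDist = vs! ; esDist = es! } u∈

    record PathAfter (i : Fin m) (v : Fin N) (vs : List (Fin N)) : Set where
      field
        start     : Fin N
        path      : Path start v
        incident  : Incident i start
        vertices⊆ : ∀ {z} → z ∈ₗ vertices path → z ∈ₗ vs
        i∉edges   : i ∉ₗ edges path

    pathAfter : ∀ {i y v} (P : Path y v) → i ∈ₗ edges P → PathAfter i v (vertices P)
    pathAfter record { walk = step j j∋y,x w ; vsAlive = _ ∷ vs ; esAlive = _ ∷ es
                     ; vsDist = _ ∷ vs! ; esDist = j∉ ∷ es! } (here refl) = record
      { path      = record { walk = w ; vsAlive = vs ; esAlive = es ; vsDist = vs! ; esDist = es! }
      ; incident  = pairIn⇒incidentʳ j∋y,x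
      ; vertices⊆ = there
      ; i∉edges   = All.All¬⇒¬Any j∉
      }
    pathAfter record { walk = step _ _ w ; vsAlive = _ ∷ vs ; esAlive = _ ∷ es
                     ; vsDist = _ ∷ vs! ; esDist = _ ∷ es! } (there i∈) =
      let A = pathAfter record { walk = w ; vsAlive = vs ; esAlive = es ; vsDist = vs! ; esDist = es! } i∈
      in record { PathAfter A ; vertices⊆ = there ∘ PathAfter.vertices⊆ A }

    -- Prepending u to a path P by the edge i: if u already lies on P, keep the
    -- suffix of P from u; if i is already used by P, restart from the vertex
    -- of i right after its use on P.
    consPath : ∀ {u y v i} (P : Path y v) → Vs u → Es i → PairIn H u y i → Path u v
    consPath {u} {i = i} P u-alive i-alive u,y∈i
      with DecMem._∈?_ _≟ᶠ_ u (vertices P) | DecMem._∈?_ _≟ᶠ_ i (edges P)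
    ... | yes u∈P | _   = pathFrom P u∈P
    ... | no  u∉P | no i∉P = record
      { walk = step i u,y∈i (PathIn.walk P)
      ; vsAlive = u-alive ∷ PathIn.vsAlive P ; esAlive = i-alive ∷ PathIn.esAlive P
      ; vsDist = All.¬Any⇒All¬ _ u∉P ∷ PathIn.vsDist P ; esDist = All.¬Any⇒All¬ _ i∉P ∷ PathIn.esDist P }
    ... | no  u∉P | yes i∈P = record
      { walk = step i (incident⇒pairIn u≢x (pairIn⇒incidentˡ u,y∈i) incident) (PathIn.walk path)
      ; vsAlive = u-alive ∷ PathIn.vsAlive path ; esAlive = i-alive ∷ PathIn.esAlive path
      ; vsDist = All.¬Any⇒All¬ _ (u∉P ∘ vertices⊆) ∷ PathIn.vsDist path
      ; esDist = All.¬Any⇒All¬ _ i∉edges ∷ PathIn.esDist path }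
      where
      open PathAfter (pathAfter P i∈P)
      u≢x : u ≢ start
      u≢x refl = u∉P (vertices⊆ (head∈walkVertices (PathIn.walk path)))

    walk⇒path : ∀ {u v} (w : Walk H u v) → All Vs (walkVertices H w) → All Es (walkEdges H w) → Path u v
    walk⇒path (here u) (u-alive ∷ []) [] = record
      { walk = here u ; vsAlive = u-alive ∷ [] ; esAlive = [] ; vsDist = [] ∷ [] ; esDist = [] }
    walk⇒path (step i u,y∈i w) (u-alive ∷ vs) (i-alive ∷ es) =
      consPath (walk⇒path w vs es) u-alive i-alive u,y∈i

    module Decide (Vs? : Decidable Vs) (Es? : Decidable Es) where

      AliveWalk≤ : ℕ → Fin N → Fin N → Set
      AliveWalk≤ L u v = Σ (Walk H u v) λ w →
        All Vs (walkVertices H w) × All Es (walkEdges H w) × length (walkEdges H w) ≤ L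

      aliveWalk≤? : ∀ L u v → Dec (AliveWalk≤ L u v)
      aliveWalk≤? zero u v with u ≟ᶠ v | Vs? u
      ... | yes refl | yes u-alive = yes (here u , u-alive ∷ [] , [] , z≤n)
      ... | yes refl | no  u-dead  = no λ { (here _ , u-alive ∷ [] , _) → u-dead u-alive
                                         ; (step _ _ _ , _ , _ , ()) }
      ... | no  u≢v  | _           = no λ { (here _ , _) → u≢v refl ; (step _ _ _ , _ , _ , ()) }
      aliveWalk≤? (suc L) u v = map′ fromCases toCases
        ((u ≟ᶠ v ×-dec Vs? u) ⊎-dec
          any? λ i → any? λ y → pairIn? u y i ×-dec Vs? u ×-dec Es? i ×-dec aliveWalk≤? L y v)
        where
        Cases : Set
        Cases = (u ≡ v × Vs u) ⊎
          ∃₂ λ i y → PairIn H u y i × Vs u × Es i × AliveWalk≤ L y v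

        fromCases : Cases → AliveWalk≤ (suc L) u v
        fromCases (inj₁ (refl , u-alive)) = here u , u-alive ∷ [] , [] , z≤n
        fromCases (inj₂ (i , y , u,y∈i , u-alive , i-alive , w , vs , es , len≤L)) =
          step i u,y∈i w , u-alive ∷ vs , i-alive ∷ es , s≤s len≤L

        toCases : AliveWalk≤ (suc L) u v → Cases
        toCases (here _ , u-alive ∷ [] , _) = inj₁ (refl , u-alive)
        toCases (step {w = y} i u,y∈i w , u-alive ∷ vs , i-alive ∷ es , s≤s len≤L) =
          inj₂ (i , y , u,y∈i , u-alive , i-alive , w , vs , es , len≤L)

      -- A path has at most N vertices, so at most N edges.
      path? : ∀ u v → Dec (Path u v)
      path? u v with aliveWalk≤? N u v
      ... | yes (w , vs , es , _) = yes (walk⇒path w vs es)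
      ... | no  ¬short = no λ P → ¬short (PathIn.walk P , PathIn.vsAlive P , PathIn.esAlive P , short P)
        where
        short : (P : Path u v) → length (edges P) ≤ N
        short P = ≤-trans (n≤1+n _)
          (subst (_≤ N) (length-walkVertices (PathIn.walk P)) (unique⇒length≤n (PathIn.vsDist P)))

      connected? : Dec (ConnectedIn H Vs Es)
      connected? = all? λ u → all? λ v → Vs? u →-dec Vs? v →-dec path? u v

      ¬connected⇒separated : ¬ ConnectedIn H Vs Es → ∃₂ λ u v → Vs u × Vs v × ¬ Path u v
      ¬connected⇒separated ¬conn
        with ¬∀⟶∃¬ N _ (λ u → all? λ v → Vs? u →-dec Vs? v →-dec path? u v) ¬conn
      ... | u , ¬conn-u with ¬∀⟶∃¬ N _ (λ v → Vs? u →-dec Vs? v →-dec path? u v) ¬conn-u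
      ...   | v , ¬conn-uv with Vs? u | Vs? v
      ...     | yes u-alive | yes v-alive = u , v , u-alive , v-alive , λ P → ¬conn-uv λ _ _ → P
      ...     | no  u-dead  | _           = ⊥-elim (¬conn-uv λ u-alive → ⊥-elim (u-dead u-alive))
      ...     | _           | no  v-dead  = ⊥-elim (¬conn-uv λ _ v-alive → ⊥-elim (v-dead v-alive))

module Deletions {N m : ℕ} (H : Hypergraph N m) where
  open Walks H

  module Weak (F : Subset m) where
    open Paths (λ _ → ⊤) (_∉ F) public
    open Decide (λ _ → yes tt) (λ i → ¬? (i ∈? F)) public

  module Strong (X : Subset N) where
    open Paths (StrongDel-V H X) (StrongDel-E H X) public
    open Decide (λ v → ¬? (v ∈? X)) (λ i → all? λ v → (v ∈? X) →-dec (edge H i v ≟ 0)) public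

  weakDisconnects? : Decidable (WeakDisconnects H)
  weakDisconnects? F = ¬? (Weak.connected? F)

  strongDisconnects? : Decidable (StrongDisconnects H)
  strongDisconnects? X = ¬? (Strong.connected? X)

  strongDisconnects⇒∣X∣<N : ∀ X → StrongDisconnects H X → ∣ X ∣ < N
  strongDisconnects⇒∣X∣<N X disc =
    let _ , _ , u∉X , _ = Strong.¬connected⇒separated X disc in x∉p⇒∣p∣<n X u∉X

  incidentEdges : Fin N → Subset m
  incidentEdges v = toSubset (λ i → 1 ≤? edge H i v)

  ∣incidentEdges∣≤deg : ∀ v → ∣ incidentEdges v ∣ ≤ deg H v
  ∣incidentEdges∣≤deg v = subst (∣ incidentEdges v ∣ ≤_)
    (cong sum (sym (map-tabulate (λ i → i) (λ i → edge H i v))))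
    (∣p∣≤sum (incidentEdges v) (λ i → edge H i v) (∈toSubset⁻ (λ i → 1 ≤? edge H i v)))

  incidentEdges-disconnect : ∀ {v w} → v ≢ w → WeakDisconnects H (incidentEdges v)
  incidentEdges-disconnect {v} {w} v≢w conn with conn v w tt tt
  ... | record { walk = here _ }                       = v≢w refl
  ... | record { walk = step i v,y∈i _ ; esAlive = i∉F ∷ _ } =
    i∉F (∈toSubset⁺ (λ i → 1 ≤? edge H i v) (pairIn⇒incidentˡ v,y∈i))

module Separation {n m : ℕ} (H : Hypergraph (suc n) m) (F : Subset m)
                  {a b : Fin (suc n)} (a↛b : ¬ Deletions.Weak.Path H F a b) where
  open Walks H
  open Deletions H
  open Weak F

  Reaches : Fin (suc n) → Set
  Reaches x = Path x b

  reaches? : Decidable Reaches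
  reaches? x = path? x b

  b-reaches : Reaches b
  b-reaches = walk⇒path (here b) (tt ∷ []) []

  reaches-along : ∀ {x y i} → Reaches x → i ∉ F → Incident i x → Incident i y → Reaches y
  reaches-along {x} {y} x↝b i∉F x∈i y∈i with y ≟ᶠ x
  ... | yes refl = x↝b
  ... | no  y≢x  = consPath x↝b tt i∉F (incident⇒pairIn y≢x y∈i x∈i)

  Crossing : Fin m → Set
  Crossing j = (∃ λ x → Reaches x × Incident j x) × (∃ λ y → ¬ Reaches y × Incident j y)

  crossing? : Decidable Crossing
  crossing? j = any? (λ x → reaches? x ×-dec (1 ≤? edge H j x))
         ×-dec any? (λ y → ¬? (reaches? y) ×-dec (1 ≤? edge H j y))

  OtherVertex : Fin (suc n) → Fin (suc n) → Fin m → Fin (suc n) → Set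
  OtherVertex c d j z = z ≢ c × z ≢ d × Incident j z

  otherVertex? : ∀ c d j → Decidable (OtherVertex c d j)
  otherVertex? c d j z = ¬? (z ≟ᶠ c) ×-dec ¬? (z ≟ᶠ d) ×-dec (1 ≤? edge H j z)

  Blocked : Fin (suc n) → Fin (suc n) → Set
  Blocked c d = ∃ λ j → j ∈ F × Crossing j × ¬ ∃ (OtherVertex c d j)

  blocked? : ∀ c d → Dec (Blocked c d)
  blocked? c d = any? λ j → (j ∈? F) ×-dec crossing? j ×-dec ¬? (any? (otherVertex? c d j))

  -- Deleting a vertex besides c and d from each edge of F strongly deletes
  -- every edge of F that leaves C, so no surviving walk from c leaves C.
  module Separator {c d} (c↝b : Reaches c) (d↛b : ¬ Reaches d) (¬blocked : ¬ Blocked c d) where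
    open Transversal (transversal F (OtherVertex c d) (otherVertex? c d)) public

    strongStep : ∀ {x y j} → Reaches x → PairIn H x y j → StrongDel-E H members j → Reaches y
    strongStep {x} {y} {j} x↝b x,y∈j j-alive with reaches? y | j ∈? F
    ... | yes y↝b | _     = y↝b
    ... | no  _   | no j∉F = reaches-along x↝b j∉F (pairIn⇒incidentˡ x,y∈j) (pairIn⇒incidentʳ x,y∈j)
    ... | no  y↛b | yes j∈F =
      let z , z≢c,d,∈j = decidable-stable (any? (otherVertex? c d j)) λ ¬other →
                           ¬blocked (j , j∈F , ((x , x↝b , pairIn⇒incidentˡ x,y∈j)
                                              , (y , y↛b , pairIn⇒incidentʳ x,y∈j)) , ¬other)
          x′ , x′∈X , (_ , _ , x′∈j) = hits j∈F z≢c,d,∈j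
      in ⊥-elim (≡0⇒¬incident (j-alive x′ x′∈X) x′∈j)

    strongWalk-stays : ∀ {x y} (w : Walk H x y) →
      Reaches x → All (StrongDel-E H members) (walkEdges H w) → Reaches y
    strongWalk-stays (here _)         x↝b _                  = x↝b
    strongWalk-stays (step _ x,y∈j w) x↝b (j-alive ∷ alive) =
      strongWalk-stays w (strongStep x↝b x,y∈j j-alive) alive

    separates : StrongDisconnects H members
    separates conn = d↛b (strongWalk-stays (PathIn.walk P) c↝b (PathIn.esAlive P))
      where
      P = conn c d (λ c∈X → proj₁ (proj₂ (sound c∈X)) refl)
                   (λ d∈X → proj₁ (proj₂ (proj₂ (sound d∈X))) refl)

  blocked-reaching≡ : ∀ {c d j x} → ¬ ∃ (OtherVertex c d j) → ¬ Reaches d →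
    Incident j x → Reaches x → x ≡ c
  blocked-reaching≡ {c} {d} {x = x} ¬other d↛b x∈j x↝b with x ≟ᶠ c | x ≟ᶠ d
  ... | yes x≡c | _        = x≡c
  ... | no  _   | yes refl = ⊥-elim (d↛b x↝b)
  ... | no  x≢c | no  x≢d  = ⊥-elim (¬other (x , x≢c , x≢d , x∈j))

  blocked-unreaching≡ : ∀ {c d j y} → ¬ ∃ (OtherVertex c d j) → Reaches c →
    Incident j y → ¬ Reaches y → y ≡ d
  blocked-unreaching≡ {c} {d} {y = y} ¬other c↝b y∈j y↛b with y ≟ᶠ c | y ≟ᶠ d
  ... | yes refl | _       = ⊥-elim (y↛b c↝b)
  ... | no  _    | yes y≡d = y≡d
  ... | no  y≢c  | no  y≢d = ⊥-elim (¬other (y , y≢c , y≢d , y∈j))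

  blockingEdge-determines : ∀ {c₁ d₁ c₂ d₂} (B₁ : Blocked c₁ d₁) (B₂ : Blocked c₂ d₂) →
    proj₁ B₁ ≡ proj₁ B₂ → Reaches c₁ → ¬ Reaches d₁ → Reaches c₂ → ¬ Reaches d₂ → c₁ ≡ c₂ × d₁ ≡ d₂
  blockingEdge-determines (j , _ , ((x , x↝b , x∈j) , (y , y↛b , y∈j)) , ¬other₁) (_ , _ , _ , ¬other₂)
                          refl c₁↝b d₁↛b c₂↝b d₂↛b =
      trans (sym (blocked-reaching≡ ¬other₁ d₁↛b x∈j x↝b)) (blocked-reaching≡ ¬other₂ d₂↛b x∈j x↝b)
    , trans (sym (blocked-unreaching≡ ¬other₁ c₁↝b y∈j y↛b)) (blocked-unreaching≡ ¬other₂ c₂↝b y∈j y↛b)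

  module AllBlocked (blocked : ∀ {c d} → Reaches c → ¬ Reaches d → Blocked c d) where

    linkEdge : ∀ x → Dec (Reaches x) → Fin m
    linkEdge x (yes x↝b) = proj₁ (blocked x↝b a↛b)
    linkEdge x (no  x↛b) = proj₁ (blocked b-reaches x↛b)

    linkEdge∈F : ∀ x (x↝b? : Dec (Reaches x)) → linkEdge x x↝b? ∈ F
    linkEdge∈F x (yes x↝b) = proj₁ (proj₂ (blocked x↝b a↛b))
    linkEdge∈F x (no  x↛b) = proj₁ (proj₂ (blocked b-reaches x↛b))

    linkEdge-injective : ∀ {x y} (x↝b? : Dec (Reaches x)) (y↝b? : Dec (Reaches y)) → x ≢ a → y ≢ a →
      linkEdge x x↝b? ≡ linkEdge y y↝b? → x ≡ y
    linkEdge-injective (yes x↝b) (yes y↝b) _ _ eq = proj₁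
      (blockingEdge-determines (blocked x↝b a↛b) (blocked y↝b a↛b) eq x↝b a↛b y↝b a↛b)
    linkEdge-injective (no x↛b) (no y↛b) _ _ eq = proj₂
      (blockingEdge-determines (blocked b-reaches x↛b) (blocked b-reaches y↛b) eq
                               b-reaches x↛b b-reaches y↛b)
    linkEdge-injective (yes x↝b) (no y↛b) _ y≢a eq = ⊥-elim (y≢a (sym (proj₂
      (blockingEdge-determines (blocked x↝b a↛b) (blocked b-reaches y↛b) eq x↝b a↛b b-reaches y↛b))))
    linkEdge-injective (no x↛b) (yes y↝b) x≢a _ eq = ⊥-elim (x≢a (proj₂
      (blockingEdge-determines (blocked b-reaches x↛b) (blocked y↝b a↛b) eq b-reaches x↛b y↝b a↛b)))

    n≤∣F∣ : n ≤ ∣ F ∣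
    n≤∣F∣ = injection⇒n≤∣p∣ F (λ i → linkEdge (punchIn a i) (reaches? (punchIn a i)))
      (λ {i} {j} eq → punchIn-injective a i j
        (linkEdge-injective (reaches? _) (reaches? _) (punchInᵢ≢i a i) (punchInᵢ≢i a j) eq))
      (λ i → linkEdge∈F (punchIn a i) (reaches? (punchIn a i)))

  strongSeparator-or-n≤∣F∣ : (∃ λ X → StrongDisconnects H X × ∣ X ∣ ≤ ∣ F ∣) ⊎ n ≤ ∣ F ∣
  strongSeparator-or-n≤∣F∣
    with any? (λ c → any? λ d → reaches? c ×-dec ¬? (reaches? d) ×-dec ¬? (blocked? c d))
  ... | yes (c , d , c↝b , d↛b , ¬blocked) =
    let open Separator c↝b d↛b ¬blocked in inj₁ (members , separates , size)
  ... | no noUnblockedPair = inj₂ (AllBlocked.n≤∣F∣ λ {c} {d} c↝b d↛b →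
    decidable-stable (blocked? c d) λ ¬blocked → noUnblockedPair (c , d , c↝b , d↛b , ¬blocked))

module Connectivity {n m : ℕ} (H : Hypergraph (suc (suc n)) m) where
  open Deletions H

  weakEdgeConnectivity≤δ : Σ ℕ λ κW → IsWeakEdgeConnectivity H κW × κW ≤ δ H
  weakEdgeConnectivity≤δ =
    let v , deg≤δ          = minFin-attained (deg H)
        star-disc          = incidentEdges-disconnect (punchInᵢ≢i v zero ∘ sym)
        Y , Y-disc , Y-min = smallestSubset weakDisconnects? (incidentEdges v , star-disc)
    in ∣ Y ∣ , ((Y , Y-disc , refl) , Y-min)
     , ≤-trans (Y-min _ star-disc) (≤-trans (∣incidentEdges∣≤deg v) deg≤δ)

  strongVertexConnectivity≤n+1 : Σ ℕ λ κS → IsStrongVertexConnectivity H κS × κS ≤ suc n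
  strongVertexConnectivity≤n+1 with anySubset? strongDisconnects?
  ... | yes (X , X-disc) =
    let Y , Y-disc , Y-min = smallestSubset strongDisconnects? (X , X-disc)
    in ∣ Y ∣ , ((λ _ → (Y , Y-disc , refl) , Y-min) , λ none → ⊥-elim (none (X , X-disc)))
     , ≤-pred (≤-trans (s≤s (Y-min X X-disc)) (strongDisconnects⇒∣X∣<N X X-disc))
  ... | no none = suc n , ((λ some → ⊥-elim (none some)) , λ _ → refl) , ≤-refl

  κS≤κW : ∀ {κS κW} → IsStrongVertexConnectivity H κS → κS ≤ suc n →
    IsWeakEdgeConnectivity H κW → κS ≤ κW
  κS≤κW isκS κS≤n+1 ((F , F-disc , refl) , _) =
    let _ , _ , _ , _ , a↛b = Weak.¬connected⇒separated F F-disc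
    in [ (λ (X , X-disc , ∣X∣≤∣F∣) → ≤-trans (proj₂ (proj₁ isκS (X , X-disc)) X X-disc) ∣X∣≤∣F∣)
       , ≤-trans κS≤n+1
       ] (Separation.strongSeparator-or-n≤∣F∣ H F a↛b)

mainTheorem1 : {n m : ℕ} (H : Hypergraph (suc (suc n)) m) →
    Σ ℕ λ κS → Σ ℕ λ κW →
      IsStrongVertexConnectivity H κS × IsWeakEdgeConnectivity H κW
        × κS ≤ κW × κW ≤ δ H
mainTheorem1 H =
  let κS , isκS , κS≤n+1 = strongVertexConnectivity≤n+1
      κW , isκW , κW≤δ   = weakEdgeConnectivity≤δ
  in κS , κW , isκS , isκW , κS≤κW isκS κS≤n+1 isκW , κW≤δ
  where open Connectivity H
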